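{- Let $G=(V,E)$ be a finite graph and $A,B\subseteq V^2$. If $\phi$ and $\phi'$ are cycle-cocycle equivalent fourientations of $G$, then $\phi$ is $(A,B)$-valid if and only if $\phi'$ is $(A,B)$-valid.
   Context: A fourientation assigns to each edge one of four configurations: 0-way, 2-way, or one of two 1-way configurations (loops included); its digraph $\vec\phi$ has two opposite arcs per 2-way edge, one arc per 1-way edge in its allowed direction, no arc for 0-way edges. $\vec G(A,B;\phi)$ is $\vec\phi$ with an arc from $u$ to $v$ added for every $(u,v)\in A$ and every $(u,v)\in B$. $\phi$ is $(A,B)$-valid if in $\vec G(A,B;\phi)$, for all $(u,v)\in A$ there is no directed path from $v$ to $u$, and for all $(u,v)\in B$ there is a directed path from $v$ to $u$. A directed cycle of $\phi$ is a directed cycle of $\vec\phi$; reversing it means reversing the 1-way edges on it, leaving 2-way edges unchanged. A directed cocycle of a digraph is a nonempty arc set $S$ for which there is a partition $V=V_1\cup V_2$ such that $S$ is the set of arcs from $V_1$ to $V_2$ and there is no arc from $V_2$ to $V_1$. An $(A,B)$-cocycle of $\phi$ is a directed cocycle of $\vec G(A,B;\phi)$ containing no arc coming from $A\cup B$; reversing it means reversing its 1-way edges. Two fourientations are cycle-cocycle equivalent if one can be obtained from the other by repeatedly reversing directed cycles and/or $(A,B)$-cocycles. -}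

module Defs where

open import Data.Nat using (ℕ)
open import Data.Fin using (Fin)
open import Data.Bool using (Bool; true; false)
open import Data.Product using (Σ; ∃; _×_; _,_; proj₁; proj₂)
open import Data.Sum using (_⊎_)
open import Data.List using (List; []; _∷_; map)
open import Data.List.Relation.Unary.Any using (Any)
open import Data.List.Relation.Unary.Unique.Propositional using (Unique)
open import Relation.Nullary using (¬_)
open import Data.Empty using (⊥)
open import Data.Unit using (⊤)
open import Relation.Binary.PropositionalEquality using (_≡_)
open import Relation.Binary.Construct.Closure.ReflexiveTransitive using (Star)

-- A finite graph (multi-edges and loops allowed): vertices Fin n, edges Fin m,
-- each edge e has a reference pair of ends (end₁ e , end₂ e).
record Graph : Set where
  field
    n : ℕ
    m : ℕ
    ends : Fin m → Fin n × Fin n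

module _ (G : Graph) where
  open Graph G

  Vertex : Set
  Vertex = Fin n

  Edge : Set
  Edge = Fin m

-- Edge configurations: 0-way, 2-way, 1-way from end₁ to end₂ (fwd),
-- 1-way from end₂ to end₁ (bwd).
data Config : Set where
  zeroWay twoWay fwd bwd : Config

flipC : Config → Config
flipC zeroWay = zeroWay
flipC twoWay  = twoWay
flipC fwd     = bwd
flipC bwd     = fwd

data Dir : Set where
  forward backward : Dir

Allowed : Config → Dir → Set
Allowed zeroWay _        = ⊥
Allowed twoWay  _        = ⊤
Allowed fwd     forward  = ⊤
Allowed fwd     backward = ⊥
Allowed bwd     forward  = ⊥
Allowed bwd     backward = ⊤

VRel : Graph → Set₁
VRel G = Vertex G → Vertex G → Set

module _ (G : Graph) where
  open Graph G

  Fourientation : Set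
  Fourientation = Edge G → Config

  -- arcs of the digraph φ⃗ : an edge together with an allowed direction
  record Arc (φ : Fourientation) : Set where
    constructor arc
    field
      edge    : Edge G
      dir     : Dir
      allowed : Allowed (φ edge) dir

  tailA : {φ : Fourientation} → Arc φ → Vertex G
  tailA (arc e forward  _) = proj₁ (ends e)
  tailA (arc e backward _) = proj₂ (ends e)

  headA : {φ : Fourientation} → Arc φ → Vertex G
  headA (arc e forward  _) = proj₂ (ends e)
  headA (arc e backward _) = proj₁ (ends e)

  StepABφ : VRel G → VRel G → Fourientation → VRel G
  StepABφ A B φ x y =
    (Σ (Arc φ) λ a → tailA a ≡ x × headA a ≡ y) ⊎ A x y ⊎ B x y

  Path : VRel G → VRel G → Fourientation → VRel G
  Path A B φ = Star (StepABφ A B φ)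

  Valid : VRel G → VRel G → Fourientation → Set
  Valid A B φ =
    (∀ u v → A u v → ¬ Path A B φ v u) × (∀ u v → B u v → Path A B φ v u)

  Chain : {φ : Fourientation} → Vertex G → List (Arc φ) → Vertex G → Set
  Chain x []       y = x ≡ y
  Chain x (a ∷ as) y = tailA a ≡ x × Chain (headA a) as y

  IsDirCycle : (φ : Fourientation) → List (Arc φ) → Set
  IsDirCycle φ []       = ⊥
  IsDirCycle φ (a ∷ as) =
    Chain (tailA a) (a ∷ as) (tailA a) × Unique (map tailA (a ∷ as))

  ReversedOn : (Edge G → Set) → Fourientation → Fourientation → Set
  ReversedOn P φ φ' =
    ∀ e → (P e → φ' e ≡ flipC (φ e)) × (¬ P e → φ' e ≡ φ e)

  -- arc of φ⃗ going from V₁ to V₂ (V₁ = {v | side v ≡ true})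
  Crossing : {φ : Fourientation} → (Vertex G → Bool) → Arc φ → Set
  Crossing side a = side (tailA a) ≡ true × side (headA a) ≡ false

  IsABCocycle : VRel G → VRel G → Fourientation → (Vertex G → Bool) → Set
  IsABCocycle A B φ side =
    (Σ (Arc φ) λ a → Crossing side a)
    × (∀ (a : Arc φ) → ¬ (side (tailA a) ≡ false × side (headA a) ≡ true))
    × (∀ u v → A u v ⊎ B u v → ¬ (side u ≡ true × side v ≡ false))
    × (∀ u v → A u v ⊎ B u v → ¬ (side u ≡ false × side v ≡ true))

  data ReverseStep (A B : VRel G) (φ φ' : Fourientation) : Set where
    revCycle : (cs : List (Arc φ)) → IsDirCycle φ cs →
      ReversedOn (λ e → Any (λ a → Arc.edge a ≡ e) cs) φ φ' →
      ReverseStep A B φ φ'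
    revCocycle : (side : Vertex G → Bool) → IsABCocycle A B φ side →
      ReversedOn (λ e → Σ (Arc φ) λ a → Arc.edge a ≡ e × Crossing side a) φ φ' →
      ReverseStep A B φ φ'

  CycleCocycleEquiv : VRel G → VRel G → Fourientation → Fourientation → Set
  CycleCocycleEquiv A B = Star (ReverseStep A B)

-- Validity only asks, for each constraint (u , v) ∈ A ∪ B, whether v reaches u in
-- G⃗(A,B;φ), so it suffices that a reversal step preserves these reachabilities.
-- Reversing a closed walk preserves reachability altogether: an arc along the walk is
-- replaced by the way round the rest of the reversed walk. Reversing an (A,B)-cocycle
-- V₁ → V₂ only changes edges between the two sides; a path between two vertices on the
-- same side never uses such an edge, since before the reversal no arc leads from V₂
-- back to V₁ and afterwards none leads from V₁ to V₂. The constraints themselves do not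
-- cross the cut, so the endpoints of each of them lie on the same side.
module Submission where

open import Defs
open import Data.Bool using (Bool; true; false; not)
open import Data.Bool.Properties using (¬-not; not-involutive) renaming (_≟_ to _≟ᵇ_)
open import Data.Empty using (⊥-elim)
open import Data.Fin using () renaming (_≟_ to _≟ᶠ_)
open import Data.List using (List; []; _∷_)
open import Data.List.Membership.Propositional using (_∈_; find; lose)
open import Data.List.Relation.Unary.All as All using (All; []; _∷_)
open import Data.List.Relation.Unary.Any using (Any; here; there; any?)
open import Data.Product using (Σ; _×_; _,_; proj₁; proj₂)
open import Data.Sum using (_⊎_; inj₁; inj₂)
open import Data.Unit using (tt)
open import Function using (flip)
open import Function.Bundles using (_⇔_; mk⇔; Equivalence)
import Function.Properties.Equivalence as ⇔
open import Relation.Binary.Construct.Closure.ReflexiveTransitive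
  using (Star; ε; _◅_; _◅◅_; _⋆; fold; reverse)
open import Relation.Binary.PropositionalEquality
open import Relation.Nullary using (¬_; yes; no)

opposite : Dir → Dir
opposite forward  = backward
opposite backward = forward

flipC-allowed : ∀ c d → Allowed c d → Allowed (flipC c) (opposite d)
flipC-allowed zeroWay d        ()
flipC-allowed twoWay  d        _ = tt
flipC-allowed fwd     forward  _ = tt
flipC-allowed fwd     backward ()
flipC-allowed bwd     forward  ()
flipC-allowed bwd     backward _ = tt

flipC-allowed⁻ : ∀ c d → Allowed (flipC c) d → Allowed c (opposite d)
flipC-allowed⁻ zeroWay d        ()
flipC-allowed⁻ twoWay  d        _ = tt
flipC-allowed⁻ fwd     forward  ()
flipC-allowed⁻ fwd     backward _ = tt
flipC-allowed⁻ bwd     forward  _ = tt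
flipC-allowed⁻ bwd     backward ()

allowed-both-ways⇒twoWay : ∀ c → Allowed c forward → Allowed c backward → c ≡ twoWay
allowed-both-ways⇒twoWay zeroWay () _
allowed-both-ways⇒twoWay twoWay  _  _ = refl
allowed-both-ways⇒twoWay fwd     _  ()
allowed-both-ways⇒twoWay bwd     () _

≡true⇒≡false⇒≢ : ∀ {p q : Bool} → p ≡ true → q ≡ false → p ≢ q
≡true⇒≡false⇒≢ refl refl ()

flipC-twoWay : ∀ {c} → c ≡ twoWay → flipC c ≡ c
flipC-twoWay refl = refl

module _ {G : Graph} where

  ArcBetween : Fourientation G → Vertex G → Vertex G → Set
  ArcBetween ψ x y = Σ (Arc G ψ) λ a → tailA G a ≡ x × headA G a ≡ y

  transport-arc : ∀ {ψ ψ'} (a : Arc G ψ) → ψ' (Arc.edge a) ≡ ψ (Arc.edge a) → Arc G ψ'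
  transport-arc a eq =
    arc (Arc.edge a) (Arc.dir a) (subst (flip Allowed (Arc.dir a)) (sym eq) (Arc.allowed a))

  transport-arc-ends : ∀ {ψ ψ'} (a : Arc G ψ) (eq : ψ' (Arc.edge a) ≡ ψ (Arc.edge a)) →
    tailA G (transport-arc {ψ' = ψ'} a eq) ≡ tailA G a ×
    headA G (transport-arc {ψ' = ψ'} a eq) ≡ headA G a
  transport-arc-ends (arc _ forward  _) _ = refl , refl
  transport-arc-ends (arc _ backward _) _ = refl , refl

  keep-arc : ∀ {ψ ψ'} (a : Arc G ψ) → ψ' (Arc.edge a) ≡ ψ (Arc.edge a) →
             ArcBetween ψ' (tailA G a) (headA G a)
  keep-arc {ψ' = ψ'} a eq = transport-arc {ψ' = ψ'} a eq , transport-arc-ends a eq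

  reverse-arc : ∀ {ψ ψ'} (a : Arc G ψ) → ψ' (Arc.edge a) ≡ flipC (ψ (Arc.edge a)) →
                ArcBetween ψ' (headA G a) (tailA G a)
  reverse-arc (arc e forward al) eq =
    arc e backward (subst (flip Allowed backward) (sym eq) (flipC-allowed _ forward al)) , refl , refl
  reverse-arc (arc e backward al) eq =
    arc e forward (subst (flip Allowed forward) (sym eq) (flipC-allowed _ backward al)) , refl , refl

  same-edge-ends : ∀ {ψ χ} (a : Arc G ψ) (c : Arc G χ) → Arc.edge c ≡ Arc.edge a →
    (tailA G c ≡ tailA G a × headA G c ≡ headA G a) ⊎
    (tailA G c ≡ headA G a × headA G c ≡ tailA G a)
  same-edge-ends (arc e forward  _) (arc _ forward  _) refl = inj₁ (refl , refl)
  same-edge-ends (arc e forward  _) (arc _ backward _) refl = inj₂ (refl , refl)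
  same-edge-ends (arc e backward _) (arc _ forward  _) refl = inj₂ (refl , refl)
  same-edge-ends (arc e backward _) (arc _ backward _) refl = inj₁ (refl , refl)

  parallel-or-twoWay : ∀ {ψ} (a c : Arc G ψ) → Arc.edge c ≡ Arc.edge a →
    ψ (Arc.edge a) ≡ twoWay ⊎ (tailA G c ≡ tailA G a × headA G c ≡ headA G a)
  parallel-or-twoWay (arc e forward  _)  (arc _ forward  _)  refl = inj₂ (refl , refl)
  parallel-or-twoWay (arc e backward _)  (arc _ backward _)  refl = inj₂ (refl , refl)
  parallel-or-twoWay (arc e forward  al) (arc _ backward al') refl =
    inj₁ (allowed-both-ways⇒twoWay _ al al')
  parallel-or-twoWay (arc e backward al) (arc _ forward  al') refl =
    inj₁ (allowed-both-ways⇒twoWay _ al' al)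

  antiparallel-or-twoWay : ∀ {ψ ψ'} (a : Arc G ψ') (c : Arc G ψ) → Arc.edge c ≡ Arc.edge a →
    ψ' (Arc.edge a) ≡ flipC (ψ (Arc.edge a)) →
    ψ (Arc.edge a) ≡ twoWay ⊎ (tailA G c ≡ headA G a × headA G c ≡ tailA G a)
  antiparallel-or-twoWay (arc e forward  _)  (arc _ backward _)   refl _ = inj₂ (refl , refl)
  antiparallel-or-twoWay (arc e backward _)  (arc _ forward  _)   refl _ = inj₂ (refl , refl)
  antiparallel-or-twoWay (arc e forward  al) (arc _ forward  al') refl eq =
    inj₁ (allowed-both-ways⇒twoWay _ al'
           (flipC-allowed⁻ _ forward (subst (flip Allowed forward) eq al)))
  antiparallel-or-twoWay (arc e backward al) (arc _ backward al') refl eq =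
    inj₁ (allowed-both-ways⇒twoWay _
           (flipC-allowed⁻ _ backward (subst (flip Allowed backward) eq al)) al')

  module _ {ψ : Fourientation G} {R : Vertex G → Vertex G → Set} where

    ArcsIn : List (Arc G ψ) → Set
    ArcsIn = All (λ a → R (tailA G a) (headA G a))

    chain-star : ∀ {x y l} → ArcsIn l → Chain G x l y → Star R x y
    chain-star []       refl        = ε
    chain-star (r ∷ rs) (refl , ch) = r ◅ chain-star rs ch

    chain-split : ∀ {x y l c} → ArcsIn l → Chain G x l y → c ∈ l →
                  Star R x (tailA G c) × Star R (headA G c) y
    chain-split (r ∷ rs) (refl , ch) (here refl) = ε , chain-star rs ch
    chain-split (r ∷ rs) (refl , ch) (there c∈) =
      let p , q = chain-split rs ch c∈ in r ◅ p , q

    closed-chain-around : ∀ {x l c} → ArcsIn l → Chain G x l x → c ∈ l →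
                          Star R (headA G c) (tailA G c)
    closed-chain-around rs ch c∈ = let p , q = chain-split rs ch c∈ in q ◅◅ p

module SideInvariance {V : Set} {S : V → V → Set} (side : V → Bool) (b : Bool)
  (no-exit : ∀ {x y} → S x y → ¬ (side x ≡ b × side y ≡ not b)) where

  step-stays : ∀ {x y} → S x y → side x ≡ b → side y ≡ b
  step-stays s x≡b = trans (¬-not (λ y≡¬b → no-exit s (x≡b , y≡¬b))) (not-involutive b)

  star-stays : ∀ {x y} → Star S x y → side x ≡ b → side y ≡ b
  star-stays ε        x≡b = x≡b
  star-stays (s ◅ ss) x≡b = star-stays ss (step-stays s x≡b)

  -- A path leaving its side could never come back.
  first-step-same-side : ∀ {x y z} → S x y → Star S y z → side x ≡ side z → side x ≡ side y
  first-step-same-side {y = y} s ss x≡z with side y ≟ᵇ b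
  ... | yes y≡b = trans x≡z (trans (star-stays ss y≡b) (sym y≡b))
  ... | no  y≢b = trans (¬-not (λ x≡b → y≢b (step-stays s x≡b))) (sym (¬-not y≢b))

  same-side-star : ∀ {S' : V → V → Set} → (∀ {x y} → S x y → side x ≡ side y → S' x y) →
                   ∀ {x y} → Star S x y → side x ≡ side y → Star S' x y
  same-side-star within ε        _   = ε
  same-side-star within (s ◅ ss) x≡z =
    let x≡y = first-step-same-side s ss x≡z in
    within s x≡y ◅ same-side-star within ss (trans (sym x≡y) x≡z)

module _ (G : Graph) (A B : VRel G) where

  private
    Step : Fourientation G → VRel G
    Step = StepABφ G A B

    PathIn : Fourientation G → VRel G
    PathIn = Path G A B

  ConstraintPathsAgree : Fourientation G → Fourientation G → Set
  ConstraintPathsAgree φ φ' = ∀ {u v} → A u v ⊎ B u v → PathIn φ v u ⇔ PathIn φ' v u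

  valid-transfer : ∀ {φ φ'} → ConstraintPathsAgree φ φ' → Valid G A B φ → Valid G A B φ'
  valid-transfer agree (no-A-paths , B-paths) =
    (λ u v uAv p → no-A-paths u v uAv (Equivalence.from (agree (inj₁ uAv)) p)) ,
    (λ u v uBv → Equivalence.to (agree (inj₂ uBv)) (B-paths u v uBv))

  module ClosedWalkReversal {φ φ' : Fourientation G} {base : Vertex G} (cs : List (Arc G φ))
    (closed : Chain G base cs base)
    (reversed : ReversedOn G (λ e → Any (λ a → Arc.edge a ≡ e) cs) φ φ') where

    forward-around : ∀ {c} → c ∈ cs → PathIn φ (headA G c) (tailA G c)
    forward-around = closed-chain-around (All.tabulate λ {a} _ → inj₁ (a , refl , refl)) closed

    backward-around : ∀ {c} → c ∈ cs → PathIn φ' (tailA G c) (headA G c)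
    backward-around c∈ =
      reverse (λ s → s) (closed-chain-around {R = flip (Step φ')} reversed-arcs closed c∈)
      where
      reversed-arcs : All (λ a → Step φ' (headA G a) (tailA G a)) cs
      reversed-arcs =
        All.tabulate λ {a} a∈ → inj₁ (reverse-arc a (proj₁ (reversed _) (lose a∈ refl)))

    step-to-reversed : ∀ {x y} → Step φ x y → PathIn φ' x y
    step-to-reversed (inj₂ ab) = inj₂ ab ◅ ε
    step-to-reversed (inj₁ (a , refl , refl)) with any? (λ c → Arc.edge c ≟ᶠ Arc.edge a) cs
    ... | no off = inj₁ (keep-arc a (proj₂ (reversed _) off)) ◅ ε
    ... | yes on with find on
    ... | c , c∈ , c-on with parallel-or-twoWay a c c-on
    ...   | inj₁ two     =
      inj₁ (keep-arc a (trans (proj₁ (reversed _) on) (flipC-twoWay two))) ◅ ε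
    ...   | inj₂ (t , h) = subst₂ (PathIn φ') t h (backward-around c∈)

    step-from-reversed : ∀ {x y} → Step φ' x y → PathIn φ x y
    step-from-reversed (inj₂ ab) = inj₂ ab ◅ ε
    step-from-reversed (inj₁ (a , refl , refl)) with any? (λ c → Arc.edge c ≟ᶠ Arc.edge a) cs
    ... | no off = inj₁ (keep-arc a (sym (proj₂ (reversed _) off))) ◅ ε
    ... | yes on with find on
    ... | c , c∈ , c-on with antiparallel-or-twoWay a c c-on (proj₁ (reversed _) on)
    ...   | inj₁ two     =
      inj₁ (keep-arc a (sym (trans (proj₁ (reversed _) on) (flipC-twoWay two)))) ◅ ε
    ...   | inj₂ (t , h) = subst₂ (PathIn φ) h t (forward-around c∈)

    reachability-preserved : ∀ {x y} → PathIn φ x y ⇔ PathIn φ' x y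
    reachability-preserved = mk⇔ (step-to-reversed ⋆) (step-from-reversed ⋆)

  module CocycleReversal {φ φ' : Fourientation G} (side : Vertex G → Bool)
    (cocycle : IsABCocycle G A B φ side)
    (reversed : ReversedOn G (λ e → Σ (Arc G φ) λ a → Arc.edge a ≡ e × Crossing G side a) φ φ') where

    private
      CrossingEdge : Edge G → Set
      CrossingEdge e = Σ (Arc G φ) λ a → Arc.edge a ≡ e × Crossing G side a

      no-arc-back : ∀ (a : Arc G φ) → ¬ (side (tailA G a) ≡ false × side (headA G a) ≡ true)
      no-arc-back = proj₁ (proj₂ cocycle)

      constraint-not-out : ∀ u v → A u v ⊎ B u v → ¬ (side u ≡ true × side v ≡ false)
      constraint-not-out = proj₁ (proj₂ (proj₂ cocycle))

      constraint-not-in : ∀ u v → A u v ⊎ B u v → ¬ (side u ≡ false × side v ≡ true)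
      constraint-not-in = proj₂ (proj₂ (proj₂ cocycle))

    constraint-same-side : ∀ {u v} → A u v ⊎ B u v → side v ≡ side u
    constraint-same-side {u} {v} ab with side u in su | side v in sv
    ... | true  | true  = refl
    ... | false | false = refl
    ... | true  | false = ⊥-elim (constraint-not-out u v ab (su , sv))
    ... | false | true  = ⊥-elim (constraint-not-in u v ab (su , sv))

    crossing-edge-changes-side : ∀ {ψ} (a : Arc G ψ) → CrossingEdge (Arc.edge a) →
                                 side (tailA G a) ≢ side (headA G a)
    crossing-edge-changes-side a (c , c-on , t-true , h-false) with same-edge-ends a c c-on
    ... | inj₁ (t , h) = ≡true⇒≡false⇒≢ (trans (cong side (sym t)) t-true)
                                        (trans (cong side (sym h)) h-false)
    ... | inj₂ (t , h) = ≢-sym (≡true⇒≡false⇒≢ (trans (cong side (sym t)) t-true)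
                                                (trans (cong side (sym h)) h-false))

    unchanged-within-side : ∀ {ψ} (a : Arc G ψ) → side (tailA G a) ≡ side (headA G a) →
                            φ' (Arc.edge a) ≡ φ (Arc.edge a)
    unchanged-within-side a same = proj₂ (reversed _) λ on → crossing-edge-changes-side a on same

    no-step-back : ∀ {x y} → Step φ x y → ¬ (side x ≡ false × side y ≡ true)
    no-step-back (inj₁ (a , refl , refl)) = no-arc-back a
    no-step-back (inj₂ ab)                = constraint-not-in _ _ ab

    no-reversed-step-out : ∀ {x y} → Step φ' x y → ¬ (side x ≡ true × side y ≡ false)
    no-reversed-step-out (inj₂ ab)                = constraint-not-out _ _ ab
    no-reversed-step-out (inj₁ (a , refl , refl)) (t-true , h-false) = not-off not-on
      where
      not-off : ¬ ¬ CrossingEdge (Arc.edge a)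
      not-off off =
        let unchanged : φ (Arc.edge a) ≡ φ' (Arc.edge a)
            unchanged = sym (proj₂ (reversed _) off)
            t , h = transport-arc-ends a unchanged
        in off (transport-arc {ψ' = φ} a unchanged , refl ,
                trans (cong side t) t-true , trans (cong side h) h-false)

      not-on : ¬ CrossingEdge (Arc.edge a)
      not-on (c@(arc _ _ _) , refl , c-t-true , c-h-false)
        with antiparallel-or-twoWay a c refl (proj₁ (reversed _) (c , refl , c-t-true , c-h-false))
      ... | inj₁ two =
        no-step-back (inj₁ (reverse-arc c (sym (flipC-twoWay two)))) (c-h-false , c-t-true)
      ... | inj₂ (t , _) = ≡true⇒≡false⇒≢ c-t-true h-false (cong side t)

    paths-agree : ConstraintPathsAgree φ φ'
    paths-agree ab = mk⇔
      (λ p → SideInvariance.same-side-star side false no-step-back within-before p same)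
      (λ p → SideInvariance.same-side-star side true no-reversed-step-out within-after p same)
      where
      same = constraint-same-side ab

      within-before : ∀ {x y} → Step φ x y → side x ≡ side y → Step φ' x y
      within-before (inj₁ (a , refl , refl)) eq = inj₁ (keep-arc a (unchanged-within-side a eq))
      within-before (inj₂ ab)                _  = inj₂ ab

      within-after : ∀ {x y} → Step φ' x y → side x ≡ side y → Step φ x y
      within-after (inj₁ (a , refl , refl)) eq = inj₁ (keep-arc a (sym (unchanged-within-side a eq)))
      within-after (inj₂ ab)                _  = inj₂ ab

  reversal-paths-agree : ∀ {φ φ'} → ReverseStep G A B φ φ' → ConstraintPathsAgree φ φ'
  reversal-paths-agree (revCycle (a ∷ as) (closed , _) reversed) =
    λ _ → ClosedWalkReversal.reachability-preserved (a ∷ as) closed reversed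
  reversal-paths-agree (revCocycle side cocycle reversed) =
    CocycleReversal.paths-agree side cocycle reversed

  equivalent-paths-agree : ∀ {φ φ'} → CycleCocycleEquiv G A B φ φ' → ConstraintPathsAgree φ φ'
  equivalent-paths-agree =
    fold ConstraintPathsAgree
         (λ step rest ab → ⇔.trans (reversal-paths-agree step ab) (rest ab))
         (λ _ → ⇔.refl)

lemma4p2 : (G : Graph) (A B : VRel G) (φ φ' : Fourientation G) →
    CycleCocycleEquiv G A B φ φ' → (Valid G A B φ ⇔ Valid G A B φ')
lemma4p2 G A B φ φ' equiv =
  mk⇔ (valid-transfer G A B agree) (valid-transfer G A B (λ ab → ⇔.sym (agree ab)))
  where
  agree : ConstraintPathsAgree G A B φ φ'
  agree = equivalent-paths-agree G A B equiv
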